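{- Let $\mathcal{M}$ be an oriented matroid on $[n]$ with set of signed circuits $\mathcal{C}$ and underlying matroid $\underline{\mathcal{M}}$ with rank function $r$. Let $K\subseteq[n]$ and $i\neq j\in[n]\setminus K$ with $r(iK)+r(jK)\neq r(ijK)+r(K)$. Then $X(i)X(j)=Y(i)Y(j)$ for all $X,Y\in\mathcal{C}$ with $\{i,j\}\subseteq\underline{X}\subseteq ijK$ and $\{i,j\}\subseteq\underline{Y}\subseteq ijK$.
   Context: A signed subset of $[n]$ is a map $X:[n]\to\{ -1,0,1\}$, with support $\underline{X}=X^{ -1}(\{1,-1\})$. An oriented matroid is given by its set $\mathcal{C}$ of signed circuits satisfying the usual circuit axioms ($\emptyset\notin\mathcal{C}$, $\mathcal{C}=-\mathcal{C}$, incomparability up to sign, and circuit elimination); its underlying matroid has as circuits the supports of the signed circuits. Notation: $iK=\{i\}\cup K$, $ijK=\{i,j\}\cup K$. -}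

module Defs where

open import Data.Nat using (ℕ; _+_; _≤_)
open import Data.Fin using (Fin)
open import Data.Fin.Subset using (Subset; _∈_; _∉_; _⊆_; _∪_; ⁅_⁆; ∣_∣)
open import Data.Bool using (Bool; true; false)
open import Data.Vec using (Vec; lookup; map)
open import Data.Product using (Σ; _×_; ∃)
open import Data.Sum using (_⊎_)
open import Relation.Nullary using (¬_)
open import Relation.Binary.PropositionalEquality using (_≡_; _≢_)

data Sign : Set where
  neg zer pos : Sign

opp : Sign → Sign
opp neg = pos
opp zer = zer
opp pos = neg

infixl 7 _·_
_·_ : Sign → Sign → Sign
zer · _   = zer
_   · zer = zer
pos · s   = s
neg · s   = opp s

nonzero : Sign → Bool
nonzero zer = false
nonzero _   = true

-- a signed subset of [n] = Fin n, as the vector (X(1),…,X(n))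
SignedSet : ℕ → Set
SignedSet n = Vec Sign n

infix 9 _⟨_⟩
_⟨_⟩ : ∀ {n} → SignedSet n → Fin n → Sign
X ⟨ i ⟩ = lookup X i

negate : ∀ {n} → SignedSet n → SignedSet n
negate = map opp

supp : ∀ {n} → SignedSet n → Subset n
supp = map nonzero

IsEmptySigned : ∀ {n} → SignedSet n → Set
IsEmptySigned X = ∀ i → X ⟨ i ⟩ ≡ zer

record IsOrientedMatroid (n : ℕ) (𝒞 : SignedSet n → Set) : Set where
  field
    nonEmpty : ∀ X → 𝒞 X → ¬ IsEmptySigned X
    symmetric : ∀ X → 𝒞 X → 𝒞 (negate X)
    incomparable : ∀ X Y → 𝒞 X → 𝒞 Y → supp X ⊆ supp Y → (X ≡ Y) ⊎ (X ≡ negate Y)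
    elimination : ∀ X Y (e : Fin n) → 𝒞 X → 𝒞 Y → X ≢ negate Y →
                  X ⟨ e ⟩ ≡ pos → Y ⟨ e ⟩ ≡ neg →
                  Σ (SignedSet n) λ Z → 𝒞 Z × Z ⟨ e ⟩ ≡ zer ×
                    (∀ f → Z ⟨ f ⟩ ≡ pos → (X ⟨ f ⟩ ≡ pos ⊎ Y ⟨ f ⟩ ≡ pos)) ×
                    (∀ f → Z ⟨ f ⟩ ≡ neg → (X ⟨ f ⟩ ≡ neg ⊎ Y ⟨ f ⟩ ≡ neg))

-- underlying matroid: circuits are supports of signed circuits;
-- a set is independent iff it contains no circuit
Independent : ∀ {n} → (SignedSet n → Set) → Subset n → Set
Independent 𝒞 I = ∀ X → 𝒞 X → ¬ (supp X ⊆ I)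

IsRank : ∀ {n} → (SignedSet n → Set) → Subset n → ℕ → Set
IsRank {n} 𝒞 A k =
  (Σ (Subset n) λ I → I ⊆ A × Independent 𝒞 I × ∣ I ∣ ≡ k) ×
  (∀ I → I ⊆ A → Independent 𝒞 I → ∣ I ∣ ≤ k)

-- The rank condition says that, inside S = ijK, every circuit through i also passes
-- through j: otherwise such a circuit would put i in the closure of K and of jK, giving
-- r(iK) = r(K) and r(ijK) = r(jK).  Strong circuit elimination turns this into the
-- converse, so i and j are in series in the restriction to S.  For two circuits X, Y of S
-- through i and j with different products X(i)X(j) ≠ Y(i)Y(j), one eliminates i between
-- them, then (if needed) an element of Y outside X, and finds a pair of circuits through
-- i and j with different products and a strictly smaller union; induction on the size
-- of the union rules this out.
module Submission where

open import Defs
open import Data.Nat using (ℕ; suc; _+_; _≤_; _<_)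
open import Data.Nat.Properties using (≤-antisym; +-comm; _≤?_)
open import Data.Nat.Induction using (<-wellFounded)
open import Induction.WellFounded using (Acc; acc)
open import Data.Fin using (Fin; zero; suc)
open import Data.Fin.Properties using (¬∀⟶∃¬) renaming (_≟_ to _≟ᶠ_)
open import Data.Fin.Subset
  using (Subset; Side; inside; outside; _∈_; _∉_; _⊆_; _∪_; ⁅_⁆; ∣_∣)
open import Data.Fin.Subset.Properties
  using (_∈?_; x∈p∪q⁻; p⊆p∪q; q⊆p∪q; p⊂q⇒∣p∣<∣q∣; x∈⁅y⁆⇒x≡y; ⊆-trans)
open import Data.Bool using (true)
open import Data.Vec using (_∷_; _[_]≔_; here; there)
open import Data.Vec.Properties
  using (lookup-map; map-∘; map-cong; map-id; []=⇒lookup; lookup⇒[]=; lookup∘update′)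
open import Data.Product using (∃; _×_; _,_; proj₂)
open import Data.Sum using (_⊎_; inj₁; inj₂; [_,_]′)
open import Data.Empty using (⊥-elim)
open import Function using (id; _∘_; const)
open import Relation.Nullary using (¬_; Dec; yes; no; contradiction)
open import Relation.Nullary.Decidable using (decidable-stable; _→-dec_)
open import Relation.Binary.PropositionalEquality

infix 4 _≟ˢ_
_≟ˢ_ : (a b : Sign) → Dec (a ≡ b)
neg ≟ˢ neg = yes refl
neg ≟ˢ zer = no λ ()
neg ≟ˢ pos = no λ ()
zer ≟ˢ neg = no λ ()
zer ≟ˢ zer = yes refl
zer ≟ˢ pos = no λ ()
pos ≟ˢ neg = no λ ()
pos ≟ˢ zer = no λ ()
pos ≟ˢ pos = yes refl

opp-involutive : ∀ a → opp (opp a) ≡ a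
opp-involutive neg = refl
opp-involutive zer = refl
opp-involutive pos = refl

·-opp : ∀ a b → opp a · opp b ≡ a · b
·-opp neg neg = refl
·-opp neg zer = refl
·-opp neg pos = refl
·-opp zer b   = refl
·-opp pos neg = refl
·-opp pos zer = refl
·-opp pos pos = refl

nonzero-opp : ∀ a → nonzero (opp a) ≡ nonzero a
nonzero-opp neg = refl
nonzero-opp zer = refl
nonzero-opp pos = refl

≢zer⇒nonzero : ∀ {a} → a ≢ zer → nonzero a ≡ true
≢zer⇒nonzero {neg} _   = refl
≢zer⇒nonzero {zer} a≢0 = contradiction refl a≢0
≢zer⇒nonzero {pos} _   = refl

nonzero⇒≢zer : ∀ {a} → nonzero a ≡ true → a ≢ zer
nonzero⇒≢zer {zer} () refl

≢zer⇒≡⊎opp≡ : ∀ {a t} → a ≢ zer → t ≢ zer → a ≡ t ⊎ opp a ≡ t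
≢zer⇒≡⊎opp≡ {neg} {neg} _ _ = inj₁ refl
≢zer⇒≡⊎opp≡ {neg} {pos} _ _ = inj₂ refl
≢zer⇒≡⊎opp≡ {pos} {neg} _ _ = inj₂ refl
≢zer⇒≡⊎opp≡ {pos} {pos} _ _ = inj₁ refl
≢zer⇒≡⊎opp≡ {zer}       a≢0 _   = contradiction refl a≢0
≢zer⇒≡⊎opp≡ {_}   {zer} _   t≢0 = contradiction refl t≢0

module _ {n : ℕ} where

  ⊈⇒∃∉ : ∀ {p q : Subset n} → ¬ p ⊆ q → ∃ λ x → x ∈ p × x ∉ q
  ⊈⇒∃∉ {p} {q} p⊈q
    with ¬∀⟶∃¬ n (λ x → x ∈ p → x ∈ q) (λ x → x ∈? p →-dec x ∈? q) (λ p⊆q → p⊈q (p⊆q _))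
  ... | x , x∈p↛x∈q =
    x , decidable-stable (x ∈? p) (λ x∉p → x∈p↛x∈q (⊥-elim ∘ x∉p)) , x∈p↛x∈q ∘ const

  ∪-least : ∀ {p q r : Subset n} → p ⊆ r → q ⊆ r → p ∪ q ⊆ r
  ∪-least {p} {q} p⊆r q⊆r x∈p∪q = [ p⊆r , q⊆r ]′ (x∈p∪q⁻ p q x∈p∪q)

  ∉-∪⁺ : ∀ {p q : Subset n} {x} → x ∉ p → x ∉ q → x ∉ p ∪ q
  ∉-∪⁺ {p} {q} x∉p x∉q x∈p∪q = [ x∉p , x∉q ]′ (x∈p∪q⁻ p q x∈p∪q)

  x∈⁅y⁆∪p∧x≢y⇒x∈p : ∀ {p : Subset n} {x y} → x ∈ ⁅ y ⁆ ∪ p → x ≢ y → x ∈ p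
  x∈⁅y⁆∪p∧x≢y⇒x∈p {p} {y = y} x∈ x≢y =
    [ (λ x∈⁅y⁆ → contradiction (x∈⁅y⁆⇒x≡y y x∈⁅y⁆) x≢y) , id ]′ (x∈p∪q⁻ ⁅ y ⁆ p x∈)

  ⊆∧∉⇒∣∣< : ∀ {p q : Subset n} {x} → p ⊆ q → x ∈ q → x ∉ p → ∣ p ∣ < ∣ q ∣
  ⊆∧∉⇒∣∣< p⊆q x∈q x∉p = p⊂q⇒∣p∣<∣q∣ (p⊆q , _ , x∈q , x∉p)

  x∈p[y]≔b⇒x∈p : ∀ {p : Subset n} {x y} {b : Side} → x ≢ y → x ∈ p [ y ]≔ b → x ∈ p
  x∈p[y]≔b⇒x∈p {p} {x} x≢y x∈ =
    lookup⇒[]= x p (trans (sym (lookup∘update′ x≢y p _)) ([]=⇒lookup x∈))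

x∉p[x]≔outside : ∀ {n} {p : Subset n} x → x ∉ p [ x ]≔ outside
x∉p[x]≔outside {p = _ ∷ _} zero    ()
x∉p[x]≔outside {p = _ ∷ _} (suc x) (there x∈) = x∉p[x]≔outside x x∈

x∈p⇒suc∣p[x]≔outside∣≡∣p∣ : ∀ {n} {p : Subset n} {x} → x ∈ p → suc ∣ p [ x ]≔ outside ∣ ≡ ∣ p ∣
x∈p⇒suc∣p[x]≔outside∣≡∣p∣ {p = inside ∷ _} here       = refl
x∈p⇒suc∣p[x]≔outside∣≡∣p∣ {p = inside ∷ _} (there x∈) = cong suc (x∈p⇒suc∣p[x]≔outside∣≡∣p∣ x∈)
x∈p⇒suc∣p[x]≔outside∣≡∣p∣ {p = outside ∷ _} (there x∈) = x∈p⇒suc∣p[x]≔outside∣≡∣p∣ x∈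

x∉p⇒∣p[x]≔inside∣≡suc∣p∣ : ∀ {n} {p : Subset n} x → x ∉ p → ∣ p [ x ]≔ inside ∣ ≡ suc ∣ p ∣
x∉p⇒∣p[x]≔inside∣≡suc∣p∣ {p = inside ∷ _} zero    x∉ = contradiction here x∉
x∉p⇒∣p[x]≔inside∣≡suc∣p∣ {p = outside ∷ _} zero    _  = refl
x∉p⇒∣p[x]≔inside∣≡suc∣p∣ {p = inside ∷ _} (suc x) x∉ =
  cong suc (x∉p⇒∣p[x]≔inside∣≡suc∣p∣ x (x∉ ∘ there))
x∉p⇒∣p[x]≔inside∣≡suc∣p∣ {p = outside ∷ _} (suc x) x∉ =
  x∉p⇒∣p[x]≔inside∣≡suc∣p∣ x (x∉ ∘ there)

module _ {n : ℕ} where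

  negate-involutive : (X : SignedSet n) → negate (negate X) ≡ X
  negate-involutive X =
    trans (sym (map-∘ opp opp X)) (trans (map-cong opp-involutive X) (map-id X))

  supp-negate : (X : SignedSet n) → supp (negate X) ≡ supp X
  supp-negate X = trans (sym (map-∘ nonzero opp X)) (map-cong nonzero-opp X)

  lookup-negate : (X : SignedSet n) (i : Fin n) → negate X ⟨ i ⟩ ≡ opp (X ⟨ i ⟩)
  lookup-negate X i = lookup-map i opp X

  ∈-supp⁺ : ∀ {X : SignedSet n} {i} → X ⟨ i ⟩ ≢ zer → i ∈ supp X
  ∈-supp⁺ {X} {i} X⟨i⟩≢0 =
    lookup⇒[]= i (supp X) (trans (lookup-map i nonzero X) (≢zer⇒nonzero X⟨i⟩≢0))

  ∈-supp⁻ : ∀ {X : SignedSet n} {i} → i ∈ supp X → X ⟨ i ⟩ ≢ zer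
  ∈-supp⁻ {X} {i} i∈X = nonzero⇒≢zer (trans (sym (lookup-map i nonzero X)) ([]=⇒lookup i∈X))

  ∉-supp⁺ : ∀ {X : SignedSet n} {i} → X ⟨ i ⟩ ≡ zer → i ∉ supp X
  ∉-supp⁺ X⟨i⟩≡0 i∈X = ∈-supp⁻ i∈X X⟨i⟩≡0

  ∈-supp-≡ : ∀ {X Y : SignedSet n} {i} → X ⟨ i ⟩ ≡ Y ⟨ i ⟩ → i ∈ supp X → i ∈ supp Y
  ∈-supp-≡ X⟨i⟩≡Y⟨i⟩ i∈X = ∈-supp⁺ (∈-supp⁻ i∈X ∘ trans X⟨i⟩≡Y⟨i⟩)

  infix 4 _≡±_
  _≡±_ : SignedSet n → SignedSet n → Set
  X ≡± Y = X ≡ Y ⊎ X ≡ negate Y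

  ≡±-sym : ∀ {X Y} → X ≡± Y → Y ≡± X
  ≡±-sym (inj₁ refl) = inj₁ refl
  ≡±-sym (inj₂ refl) = inj₂ (sym (negate-involutive _))

  ≡±-trans : ∀ {X Y Z} → X ≡± Y → Y ≡± Z → X ≡± Z
  ≡±-trans (inj₁ refl) Y≡±Z       = Y≡±Z
  ≡±-trans (inj₂ refl) (inj₁ refl) = inj₂ refl
  ≡±-trans (inj₂ refl) (inj₂ refl) = inj₁ (negate-involutive _)

  ≡±-∈ : ∀ {X Y} {i} → X ≡± Y → i ∈ supp X → i ∈ supp Y
  ≡±-∈ (inj₁ refl) i∈ = i∈
  ≡±-∈ {i = i} (inj₂ refl) i∈ = subst (i ∈_) (supp-negate _) i∈

  ≡±-· : ∀ {X Y} → X ≡± Y → ∀ e f → X ⟨ e ⟩ · X ⟨ f ⟩ ≡ Y ⟨ e ⟩ · Y ⟨ f ⟩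
  ≡±-· (inj₁ refl) e f = refl
  ≡±-· {Y = Y} (inj₂ refl) e f =
    trans (cong₂ _·_ (lookup-negate Y e) (lookup-negate Y f)) (·-opp (Y ⟨ e ⟩) (Y ⟨ f ⟩))

  orient : ∀ X {e} (t : Sign) → e ∈ supp X → t ≢ zer → ∃ λ X′ → X′ ≡± X × X′ ⟨ e ⟩ ≡ t
  orient X {e} t e∈X t≢0 =
    [ (λ X⟨e⟩≡t → X , inj₁ refl , X⟨e⟩≡t)
    , (λ oppX⟨e⟩≡t → negate X , inj₂ refl , trans (lookup-negate X e) oppX⟨e⟩≡t)
    ]′ (≢zer⇒≡⊎opp≡ (∈-supp⁻ e∈X) t≢0)

module OrientedMatroid {n : ℕ} {𝒞 : SignedSet n → Set} (om : IsOrientedMatroid n 𝒞) where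

  open IsOrientedMatroid om

  ≡±-circuit : ∀ {X Y} → 𝒞 Y → X ≡± Y → 𝒞 X
  ≡±-circuit cY (inj₁ refl) = cY
  ≡±-circuit cY (inj₂ refl) = symmetric _ cY

  circuit-⊈ : ∀ {Z X e} → 𝒞 Z → 𝒞 X → e ∉ supp Z → e ∈ supp X → ∃ λ g → g ∈ supp Z × g ∉ supp X
  circuit-⊈ cZ cX e∉Z e∈X =
    ⊈⇒∃∉ λ Z⊆X → e∉Z (≡±-∈ (≡±-sym (incomparable _ _ cZ cX Z⊆X)) e∈X)

  record Elimination (X Y : SignedSet n) (e : Fin n) : Set where
    field
      Z       : SignedSet n
      circuit : 𝒞 Z
      e∉Z     : e ∉ supp Z
      Z⊆X∪Y   : supp Z ⊆ supp X ∪ supp Y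
      X′      : SignedSet n
      X′≡±X   : X′ ≡± X
      agrees  : ∀ {h} → h ∈ supp Z → h ∉ supp Y → Z ⟨ h ⟩ ≡ X′ ⟨ h ⟩

  eliminate : ∀ {X Y} e → 𝒞 X → 𝒞 Y → ¬ X ≡± Y → e ∈ supp X → e ∈ supp Y → Elimination X Y e
  eliminate {X} {Y} e cX cY X≢±Y e∈X e∈Y
    with orient X pos e∈X (λ ()) | orient Y neg e∈Y (λ ())
  ... | X′ , X′≡±X , X′⟨e⟩≡+ | Y′ , Y′≡±Y , Y′⟨e⟩≡-
    with elimination X′ Y′ e (≡±-circuit cX X′≡±X) (≡±-circuit cY Y′≡±Y)
           (λ X′≡-Y′ → X≢±Y (≡±-trans (≡±-sym X′≡±X) (≡±-trans (inj₂ X′≡-Y′) Y′≡±Y)))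
           X′⟨e⟩≡+ Y′⟨e⟩≡-
  ... | Z , cZ , Z⟨e⟩≡0 , pos-from , neg-from = record
    { Z       = Z
    ; circuit = cZ
    ; e∉Z     = ∉-supp⁺ Z⟨e⟩≡0
    ; Z⊆X∪Y   = λ h∈Z →
        [ (λ Z≡X′ → p⊆p∪q _ (≡±-∈ X′≡±X (∈-supp-≡ Z≡X′ h∈Z)))
        , (λ Z≡Y′ → q⊆p∪q _ _ (≡±-∈ Y′≡±Y (∈-supp-≡ Z≡Y′ h∈Z)))
        ]′ (conformal h∈Z)
    ; X′      = X′
    ; X′≡±X   = X′≡±X
    ; agrees  = λ h∈Z h∉Y →
        [ id
        , (λ Z≡Y′ → contradiction (≡±-∈ Y′≡±Y (∈-supp-≡ Z≡Y′ h∈Z)) h∉Y)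
        ]′ (conformal h∈Z)
    }
    where
    conformal : ∀ {h} → h ∈ supp Z → Z ⟨ h ⟩ ≡ X′ ⟨ h ⟩ ⊎ Z ⟨ h ⟩ ≡ Y′ ⟨ h ⟩
    conformal {h} h∈Z with Z ⟨ h ⟩ in Z⟨h⟩≡
    ... | pos = Data.Sum.map sym sym (pos-from h Z⟨h⟩≡)
    ... | neg = Data.Sum.map sym sym (neg-from h Z⟨h⟩≡)
    ... | zer = contradiction Z⟨h⟩≡ (∈-supp⁻ h∈Z)

  record StrongElimination (X Y : SignedSet n) (e f : Fin n) : Set where
    field
      Z       : SignedSet n
      circuit : 𝒞 Z
      e∉Z     : e ∉ supp Z
      f∈Z     : f ∈ supp Z
      Z⊆X∪Y   : supp Z ⊆ supp X ∪ supp Y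

  strong-elimination : ∀ {X Y e f} → 𝒞 X → 𝒞 Y → e ∈ supp X → e ∈ supp Y →
                       f ∈ supp X → f ∉ supp Y → StrongElimination X Y e f
  strong-elimination = go (<-wellFounded _)
    where
    go : ∀ {X Y e f} → Acc _<_ ∣ supp X ∪ supp Y ∣ → 𝒞 X → 𝒞 Y → e ∈ supp X → e ∈ supp Y →
         f ∈ supp X → f ∉ supp Y → StrongElimination X Y e f
    go {X} {Y} {e} {f} (acc rec) cX cY e∈X e∈Y f∈X f∉Y = byCases (f ∈? supp E.Z)
      where
      module E = Elimination (eliminate e cX cY (λ X≡±Y → f∉Y (≡±-∈ X≡±Y f∈X)) e∈X e∈Y)

      byCases : Dec (f ∈ supp E.Z) → StrongElimination X Y e f
      byCases (yes f∈Z) = record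
        { Z = E.Z ; circuit = E.circuit ; e∉Z = E.e∉Z ; f∈Z = f∈Z ; Z⊆X∪Y = E.Z⊆X∪Y }
      byCases (no f∉Z) with circuit-⊈ E.circuit cX E.e∉Z e∈X
      ... | g , g∈Z , g∉X = record
        { Z = V.Z ; circuit = V.circuit ; e∉Z = V.e∉Z ; f∈Z = V.f∈Z
        ; Z⊆X∪Y = ⊆-trans V.Z⊆X∪Y (∪-least (p⊆p∪q _) W⊆X∪Y) }
        where
        g∈Y : g ∈ supp Y
        g∈Y = [ (λ g∈X → contradiction g∈X g∉X) , id ]′ (x∈p∪q⁻ _ _ (E.Z⊆X∪Y g∈Z))
        Y∪Z⊆X∪Y : supp Y ∪ supp E.Z ⊆ supp X ∪ supp Y
        Y∪Z⊆X∪Y = ∪-least (q⊆p∪q _ _) E.Z⊆X∪Y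
        module W = StrongElimination
          (go (rec (⊆∧∉⇒∣∣< Y∪Z⊆X∪Y (p⊆p∪q _ f∈X) (∉-∪⁺ f∉Y f∉Z)))
              cY E.circuit g∈Y g∈Z e∈Y E.e∉Z)
        W⊆X∪Y : supp W.Z ⊆ supp X ∪ supp Y
        W⊆X∪Y = ⊆-trans W.Z⊆X∪Y Y∪Z⊆X∪Y
        module V = StrongElimination
          (go (rec (⊆∧∉⇒∣∣< (∪-least (p⊆p∪q _) W⊆X∪Y) (q⊆p∪q _ _ g∈Y) (∉-∪⁺ g∉X W.e∉Z)))
              cX W.circuit e∈X W.f∈Z f∈X (∉-∪⁺ f∉Y f∉Z ∘ W.Z⊆X∪Y))

  -- Exchange argument: the bound is decidable, so it suffices to refute its failure, and
  -- under that assumption the exchanged set I - e + z is independent.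
  independent-bound : ∀ {A r C e} → (∀ J → J ⊆ A → Independent 𝒞 J → ∣ J ∣ ≤ r) →
                      𝒞 C → e ∈ supp C → supp C ⊆ ⁅ e ⁆ ∪ A →
                      ∀ I → I ⊆ ⁅ e ⁆ ∪ A → Independent 𝒞 I → ∣ I ∣ ≤ r
  independent-bound {A} {r} {e = e} bound cC e∈C C⊆eA I I⊆eA indI = go (<-wellFounded _) cC e∈C C⊆eA
    where
    go : ∀ {C} → Acc _<_ ∣ supp C ∪ I ∣ → 𝒞 C → e ∈ supp C → supp C ⊆ ⁅ e ⁆ ∪ A → ∣ I ∣ ≤ r
    go {C} (acc rec) cC e∈C C⊆eA with e ∈? I | ⊈⇒∃∉ (indI C cC)
    ... | no e∉I | _ = bound I (λ x∈I → x∈⁅y⁆∪p∧x≢y⇒x∈p (I⊆eA x∈I) λ { refl → e∉I x∈I }) indI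
    ... | yes e∈I | z , z∈C , z∉I = decidable-stable (∣ I ∣ ≤? r) λ ∣I∣≰r →
          ∣I∣≰r (subst (_≤ r) ∣I′∣≡∣I∣ (bound I′ I′⊆A (I′-independent ∣I∣≰r)))
      where
      z≢e : z ≢ e
      z≢e refl = z∉I e∈I

      I′ : Subset n
      I′ = I [ e ]≔ outside [ z ]≔ inside

      ∈I′ : ∀ {x} → x ∈ I′ → x ≡ z ⊎ (x ≢ e × x ∈ I)
      ∈I′ {x} x∈I′ with x ≟ᶠ z
      ... | yes x≡z = inj₁ x≡z
      ... | no x≢z  = inj₂ (x≢e , x∈p[y]≔b⇒x∈p x≢e x∈I-e)
        where
        x∈I-e : x ∈ I [ e ]≔ outside
        x∈I-e = x∈p[y]≔b⇒x∈p x≢z x∈I′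
        x≢e : x ≢ e
        x≢e refl = x∉p[x]≔outside e x∈I-e

      ∣I′∣≡∣I∣ : ∣ I′ ∣ ≡ ∣ I ∣
      ∣I′∣≡∣I∣ = trans (x∉p⇒∣p[x]≔inside∣≡suc∣p∣ z (z∉I ∘ x∈p[y]≔b⇒x∈p z≢e))
                       (x∈p⇒suc∣p[x]≔outside∣≡∣p∣ e∈I)

      I′⊆A : I′ ⊆ A
      I′⊆A x∈I′ with ∈I′ x∈I′
      ... | inj₁ refl          = x∈⁅y⁆∪p∧x≢y⇒x∈p (C⊆eA z∈C) z≢e
      ... | inj₂ (x≢e , x∈I) = x∈⁅y⁆∪p∧x≢y⇒x∈p (I⊆eA x∈I) x≢e

      I′-independent : ¬ ∣ I ∣ ≤ r → Independent 𝒞 I′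
      I′-independent ∣I∣≰r D cD D⊆I′ with z ∈? supp D
      ... | no z∉D = indI D cD λ x∈D →
            [ (λ { refl → contradiction x∈D z∉D }) , proj₂ ]′ (∈I′ (D⊆I′ x∈D))
      ... | yes z∈D = ∣I∣≰r (go (rec smaller) C′.circuit C′.f∈Z C′⊆eA)
        where
        e∉D : e ∉ supp D
        e∉D e∈D = [ z≢e ∘ sym , (λ (e≢e , _) → e≢e refl) ]′ (∈I′ (D⊆I′ e∈D))
        module C′ = StrongElimination (strong-elimination cC cD z∈C z∈D e∈C e∉D)
        C′⊆eA : supp C′.Z ⊆ ⁅ e ⁆ ∪ A
        C′⊆eA = ⊆-trans C′.Z⊆X∪Y (∪-least C⊆eA (⊆-trans D⊆I′ (⊆-trans I′⊆A (q⊆p∪q _ _))))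
        C′⊆C∪I : supp C′.Z ⊆ supp C ∪ I
        C′⊆C∪I {x} x∈C′ with x∈p∪q⁻ _ _ (C′.Z⊆X∪Y x∈C′)
        ... | inj₁ x∈C = p⊆p∪q _ x∈C
        ... | inj₂ x∈D = [ (λ { refl → p⊆p∪q _ z∈C }) , q⊆p∪q _ _ ∘ proj₂ ]′ (∈I′ {x} (D⊆I′ x∈D))
        smaller : ∣ supp C′.Z ∪ I ∣ < ∣ supp C ∪ I ∣
        smaller = ⊆∧∉⇒∣∣< (∪-least C′⊆C∪I (q⊆p∪q _ _)) (p⊆p∪q _ z∈C) (∉-∪⁺ C′.e∉Z z∉I)

  spanned⇒rank-≡ : ∀ {A C e r₁ r₀} → IsRank 𝒞 (⁅ e ⁆ ∪ A) r₁ → IsRank 𝒞 A r₀ →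
                   𝒞 C → e ∈ supp C → supp C ⊆ ⁅ e ⁆ ∪ A → r₁ ≡ r₀
  spanned⇒rank-≡ ((I , I⊆eA , indI , refl) , bound₁) ((J , J⊆A , indJ , refl) , bound₀)
                 cC e∈C C⊆eA =
    ≤-antisym (independent-bound bound₀ cC e∈C C⊆eA I I⊆eA indI)
              (bound₁ J (⊆-trans J⊆A (q⊆p∪q _ _)) indJ)

  rank-gap⇒series : ∀ {K i j riK rjK rijK rK C} →
                    IsRank 𝒞 (⁅ i ⁆ ∪ K) riK → IsRank 𝒞 (⁅ j ⁆ ∪ K) rjK →
                    IsRank 𝒞 (⁅ i ⁆ ∪ (⁅ j ⁆ ∪ K)) rijK → IsRank 𝒞 K rK →
                    riK + rjK ≢ rijK + rK →
                    𝒞 C → supp C ⊆ ⁅ i ⁆ ∪ (⁅ j ⁆ ∪ K) → i ∈ supp C → j ∈ supp C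
  rank-gap⇒series {K} {i} {j} {riK} {rjK} {rijK} {rK} {C} r-iK r-jK r-ijK r-K gap cC C⊆ijK i∈C =
    decidable-stable (j ∈? supp C) λ j∉C → gap (begin
      riK + rjK   ≡⟨ cong (_+ rjK) (spanned⇒rank-≡ r-iK r-K cC i∈C (C⊆iK j∉C)) ⟩
      rK + rjK    ≡⟨ +-comm rK rjK ⟩
      rjK + rK    ≡⟨ cong (_+ rK) (sym (spanned⇒rank-≡ r-ijK r-jK cC i∈C C⊆ijK)) ⟩
      rijK + rK   ∎)
    where
    open ≡-Reasoning
    C⊆iK : j ∉ supp C → supp C ⊆ ⁅ i ⁆ ∪ K
    C⊆iK j∉C x∈C =
      [ p⊆p∪q _
      , (λ x∈jK → q⊆p∪q _ _ (x∈⁅y⁆∪p∧x≢y⇒x∈p x∈jK λ { refl → j∉C x∈C }))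
      ]′ (x∈p∪q⁻ _ _ (C⊆ijK x∈C))

  series-converse : ∀ {S X e f} → 𝒞 X → supp X ⊆ S → e ∈ supp X → f ∈ supp X →
                    (∀ {C} → 𝒞 C → supp C ⊆ S → e ∈ supp C → f ∈ supp C) →
                    ∀ {C} → 𝒞 C → supp C ⊆ S → f ∈ supp C → e ∈ supp C
  series-converse {e = e} cX X⊆S e∈X f∈X e⇒f {C} cC C⊆S f∈C =
    decidable-stable (e ∈? supp C) λ e∉C →
      let module V = StrongElimination (strong-elimination cX cC f∈X f∈C e∈X e∉C)
      in V.e∉Z (e⇒f V.circuit (⊆-trans V.Z⊆X∪Y (∪-least X⊆S C⊆S)) V.f∈Z)

  module Series (S : Subset n) (e f : Fin n)
    (f⇒e : ∀ {C} → 𝒞 C → supp C ⊆ S → f ∈ supp C → e ∈ supp C)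
    (e⇒f : ∀ {C} → 𝒞 C → supp C ⊆ S → e ∈ supp C → f ∈ supp C) where

    parity : SignedSet n → Sign
    parity X = X ⟨ e ⟩ · X ⟨ f ⟩

    Through : SignedSet n → Set
    Through X = 𝒞 X × supp X ⊆ S × f ∈ supp X

    ≡±-parity : ∀ {X Y} → X ≡± Y → parity X ≡ parity Y
    ≡±-parity X≡±Y = ≡±-· X≡±Y e f

    ParityBelow : ℕ → Set
    ParityBelow m = ∀ {X Y} → ∣ supp X ∪ supp Y ∣ < m → Through X → Through Y → parity X ≡ parity Y

    -- The circuit V obtained by eliminating some h ∈ Z ∖ Y against X misses h and y, so
    -- it can be compared with both X and Y by induction.
    avoiding-∌y⇒parity-≡ : ∀ {X Y Z y} → ParityBelow ∣ supp X ∪ supp Y ∣ →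
                           Through X → Through Y →
                           𝒞 Z → supp Z ⊆ supp X ∪ supp Y → e ∉ supp Z → f ∉ supp Z →
                           y ∈ supp Y → y ∉ supp X → y ∉ supp Z → parity X ≡ parity Y
    avoiding-∌y⇒parity-≡ {X} {Y} ih tX@(cX , X⊆S , f∈X) tY@(cY , Y⊆S , f∈Y)
                         cZ Z⊆X∪Y e∉Z f∉Z y∈Y y∉X y∉Z
      with circuit-⊈ cZ cY e∉Z (f⇒e cY Y⊆S f∈Y)
    ... | h , h∈Z , h∉Y = trans (ih X∪V<X∪Y tX tV) (sym (ih Y∪V<X∪Y tY tV))
      where
      h∈X : h ∈ supp X
      h∈X = [ id , (λ h∈Y → contradiction h∈Y h∉Y) ]′ (x∈p∪q⁻ _ _ (Z⊆X∪Y h∈Z))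
      module V = StrongElimination (strong-elimination cX cZ h∈X h∈Z f∈X f∉Z)
      V⊆X∪Y : supp V.Z ⊆ supp X ∪ supp Y
      V⊆X∪Y = ⊆-trans V.Z⊆X∪Y (∪-least (p⊆p∪q _) Z⊆X∪Y)
      tV : Through V.Z
      tV = V.circuit , ⊆-trans V⊆X∪Y (∪-least X⊆S Y⊆S) , V.f∈Z
      X∪V<X∪Y : ∣ supp X ∪ supp V.Z ∣ < ∣ supp X ∪ supp Y ∣
      X∪V<X∪Y = ⊆∧∉⇒∣∣< (∪-least (p⊆p∪q _) V⊆X∪Y) (q⊆p∪q _ _ y∈Y)
                        (∉-∪⁺ y∉X (∉-∪⁺ y∉X y∉Z ∘ V.Z⊆X∪Y))
      Y∪V<X∪Y : ∣ supp Y ∪ supp V.Z ∣ < ∣ supp X ∪ supp Y ∣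
      Y∪V<X∪Y = ⊆∧∉⇒∣∣< (∪-least (q⊆p∪q _ _) V⊆X∪Y) (p⊆p∪q _ h∈X) (∉-∪⁺ h∉Y V.e∉Z)

    avoiding⇒parity-≡ : ∀ {X Y Z g} → ParityBelow ∣ supp X ∪ supp Y ∣ →
                        Through X → Through Y →
                        𝒞 Z → supp Z ⊆ supp X ∪ supp Y → e ∉ supp Z → f ∉ supp Z →
                        g ∈ supp Y → g ∉ supp X → parity X ≡ parity Y
    avoiding⇒parity-≡ {X} {Y} {Z} {g} ih tX@(cX , X⊆S , f∈X) tY@(cY , Y⊆S , f∈Y)
                      cZ Z⊆X∪Y e∉Z f∉Z g∈Y g∉X
      with g ∈? supp Z
    ... | no g∉Z  = avoiding-∌y⇒parity-≡ ih tX tY cZ Z⊆X∪Y e∉Z f∉Z g∈Y g∉X g∉Z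
    ... | yes g∈Z = byCases (f ∈? supp W.Z)
      where
      e∈Y : e ∈ supp Y
      e∈Y = f⇒e cY Y⊆S f∈Y
      module W = Elimination (eliminate g cY cZ (λ Y≡±Z → e∉Z (≡±-∈ Y≡±Z e∈Y)) g∈Y g∈Z)
      W⊆X∪Y : supp W.Z ⊆ supp X ∪ supp Y
      W⊆X∪Y = ⊆-trans W.Z⊆X∪Y (∪-least (q⊆p∪q _ _) Z⊆X∪Y)
      W⊆S : supp W.Z ⊆ S
      W⊆S = ⊆-trans W⊆X∪Y (∪-least X⊆S Y⊆S)

      byCases : Dec (f ∈ supp W.Z) → parity X ≡ parity Y
      byCases (no f∉W) =
        avoiding-∌y⇒parity-≡ ih tX tY W.circuit W⊆X∪Y (f∉W ∘ e⇒f W.circuit W⊆S) f∉W g∈Y g∉X W.e∉Z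
      byCases (yes f∈W) = begin
        parity X      ≡⟨ ih X∪W<X∪Y tX (W.circuit , W⊆S , f∈W) ⟩
        parity W.Z    ≡⟨ cong₂ _·_ (W.agrees (f⇒e W.circuit W⊆S f∈W) e∉Z) (W.agrees f∈W f∉Z) ⟩
        parity W.X′   ≡⟨ ≡±-parity W.X′≡±X ⟩
        parity Y      ∎
        where
        open ≡-Reasoning
        X∪W<X∪Y : ∣ supp X ∪ supp W.Z ∣ < ∣ supp X ∪ supp Y ∣
        X∪W<X∪Y = ⊆∧∉⇒∣∣< (∪-least (p⊆p∪q _) W⊆X∪Y) (q⊆p∪q _ _ g∈Y) (∉-∪⁺ g∉X W.e∉Z)

    parity-step : ∀ {X Y} → ParityBelow ∣ supp X ∪ supp Y ∣ → Through X → Through Y →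
                  parity X ≡ parity Y
    parity-step {X} {Y} ih tX@(cX , X⊆S , f∈X) tY@(cY , Y⊆S , f∈Y) with parity X ≟ˢ parity Y
    ... | yes X≡Y = X≡Y
    ... | no X≢Y with ⊈⇒∃∉ (X≢Y ∘ sym ∘ ≡±-parity ∘ incomparable Y X cY cX)
    ...   | g , g∈Y , g∉X =
            avoiding⇒parity-≡ ih tX tY Z₀.circuit Z₀.Z⊆X∪Y Z₀.e∉Z
              (Z₀.e∉Z ∘ f⇒e Z₀.circuit (⊆-trans Z₀.Z⊆X∪Y (∪-least X⊆S Y⊆S))) g∈Y g∉X
      where
      module Z₀ = Elimination
        (eliminate e cX cY (X≢Y ∘ ≡±-parity) (f⇒e cX X⊆S f∈X) (f⇒e cY Y⊆S f∈Y))

    parity-constant : ∀ {X Y} → Through X → Through Y → parity X ≡ parity Y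
    parity-constant = go (<-wellFounded _)
      where
      go : ∀ {X Y} → Acc _<_ ∣ supp X ∪ supp Y ∣ → Through X → Through Y → parity X ≡ parity Y
      go (acc rec) = parity-step (λ lt → go (rec lt))

lemma3p1 : (n : ℕ) (𝒞 : SignedSet n → Set) → IsOrientedMatroid n 𝒞 →
           (K : Subset n) (i j : Fin n) → i ≢ j → i ∉ K → j ∉ K →
           (riK rjK rijK rK : ℕ) →
           IsRank 𝒞 (⁅ i ⁆ ∪ K) riK → IsRank 𝒞 (⁅ j ⁆ ∪ K) rjK →
           IsRank 𝒞 (⁅ i ⁆ ∪ (⁅ j ⁆ ∪ K)) rijK → IsRank 𝒞 K rK →
           riK + rjK ≢ rijK + rK →
           ∀ X Y → 𝒞 X → 𝒞 Y →
           i ∈ supp X → j ∈ supp X → supp X ⊆ ⁅ i ⁆ ∪ (⁅ j ⁆ ∪ K) →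
           i ∈ supp Y → j ∈ supp Y → supp Y ⊆ ⁅ i ⁆ ∪ (⁅ j ⁆ ∪ K) →
           X ⟨ i ⟩ · X ⟨ j ⟩ ≡ Y ⟨ i ⟩ · Y ⟨ j ⟩
lemma3p1 _ 𝒞 om K i j _ _ _ _ _ _ _ r-iK r-jK r-ijK r-K gap
         X Y cX cY i∈X j∈X X⊆ijK _ j∈Y Y⊆ijK =
  parity-constant (cX , X⊆ijK , j∈X) (cY , Y⊆ijK , j∈Y)
  where
  open OrientedMatroid om
  i⇒j : ∀ {C} → 𝒞 C → supp C ⊆ ⁅ i ⁆ ∪ (⁅ j ⁆ ∪ K) → i ∈ supp C → j ∈ supp C
  i⇒j = rank-gap⇒series r-iK r-jK r-ijK r-K gap
  open Series (⁅ i ⁆ ∪ (⁅ j ⁆ ∪ K)) i j (series-converse cX X⊆ijK i∈X j∈X i⇒j) i⇒j
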